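{- The edge Folkman number $F_e(K_3,K_3;B_3)$ does not exist; that is, for every $B_3$-free graph $G$ there is a red-blue coloring of the edges of $G$ with no monochromatic triangle.
   Context: All graphs are finite, undirected and simple. The join $G+H$ of vertex-disjoint graphs is their union together with all edges between them. The book graph $B_k$ is $K_1 + K_{1,k}$; $B_3$ consists of three triangles sharing a common edge. A graph is $H$-free if it contains no subgraph isomorphic to $H$. $F_e(K_3,K_3;H)$ is the smallest $n$ such that some $H$-free graph on $n$ vertices has the property that every red-blue edge coloring contains a monochromatic $K_3$; it "exists" if such a graph exists. -}

module Defs where

open import Data.Nat using (ℕ)
open import Data.Fin using (Fin)
open import Data.Bool using (Bool; true; false)
open import Data.Product using (Σ; _×_; ∃-syntax)
open import Relation.Binary.PropositionalEquality using (_≡_; _≢_)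
open import Relation.Nullary using (¬_)

record Graph (n : ℕ) : Set where
  field
    adj   : Fin n → Fin n → Bool
    sym   : ∀ x y → adj x y ≡ adj y x
    irrefl : ∀ x → adj x x ≡ false
open Graph public

Edge : ∀ {n} → Graph n → Fin n → Fin n → Set
Edge G x y = adj G x y ≡ true

ContainsB₃ : ∀ {n} → Graph n → Set
ContainsB₃ {n} G =
  ∃[ u ] ∃[ v ] ∃[ a ] ∃[ b ] ∃[ c ]
    ( u ≢ v × u ≢ a × u ≢ b × u ≢ c × v ≢ a × v ≢ b × v ≢ c
    × a ≢ b × a ≢ c × b ≢ c
    × Edge G u v
    × Edge G u a × Edge G v a
    × Edge G u b × Edge G v b
    × Edge G u c × Edge G v c )

B₃-free : ∀ {n} → Graph n → Set
B₃-free G = ¬ ContainsB₃ G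

-- A red-blue edge colouring: a symmetric function assigning a colour (Bool)
-- to each pair; only its values on edges matter.
record EdgeColouring {n} (G : Graph n) : Set where
  field
    colour : Fin n → Fin n → Bool
    colour-sym : ∀ x y → colour x y ≡ colour y x
open EdgeColouring public

MonoTriangle : ∀ {n} (G : Graph n) → EdgeColouring G → Set
MonoTriangle {n} G c =
  ∃[ x ] ∃[ y ] ∃[ z ]
    ( x ≢ y × x ≢ z × y ≢ z
    × Edge G x y × Edge G x z × Edge G y z
    × colour c x y ≡ colour c x z × colour c x y ≡ colour c y z )

module Submission where

-- Induction on the number of vertices. Colour G − 0 without monochromatic
-- triangles; it remains to colour the edges 0i, i.e. to choose f(i) for the
-- neighbours i of 0, and a triangle 0ij is monochromatic iff
-- f(i) = f(j) = c(ij). In the link of 0 (the graph induced on its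
-- neighbourhood) a vertex with three neighbours would give a B₃ on the edge
-- from 0 to it, so the link has maximum degree 2. In such a graph every edge
-- colouring c admits an f with no edge ij having f(i) = f(j) = c(ij): delete
-- a vertex v with a neighbour y, solve the rest with f(y) pinned to ¬c(vy)
-- (possible since y now has degree at most 1), and give v the opposite of the
-- colour of its other edge.

open import Defs renaming (sym to adj-sym)
open import Data.Nat using (ℕ; zero; suc)
open import Data.Fin using (Fin; zero; suc; punchIn; punchOut)
open import Data.Fin.Properties
  using (_≟_; any?; suc-injective; punchIn-injective; punchInᵢ≢i; punchIn-punchOut)
open import Data.Vec.Functional using (insertAt)
open import Data.Vec.Functional.Properties using (insertAt-lookup; insertAt-punchIn)
open import Data.Bool using (Bool; true; false; not; _∧_)
import Data.Bool.Properties as Bool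
open import Data.Product using (_×_; _,_; ∃-syntax)
open import Data.Empty using (⊥)
open import Function using (_∘_)
open import Relation.Nullary using (¬_; yes; no; Dec)
open import Relation.Nullary.Decidable using (¬?; _×-dec_)
open import Relation.Binary.PropositionalEquality
  using (_≡_; _≢_; refl; sym; trans; cong; cong₂; subst)

private
  variable
    m : ℕ

edge⇒≢ : (H : Graph m) {x y : Fin m} → Edge H x y → x ≢ y
edge⇒≢ H {x} e refl with () ← trans (sym e) (irrefl H x)

edge-sym : (H : Graph m) {x y : Fin m} → Edge H x y → Edge H y x
edge-sym H {x} {y} e = trans (adj-sym H y x) e

neighbour? : (H : Graph m) (v : Fin m) → Dec (∃[ y ] Edge H v y)
neighbour? H v = any? (λ y → adj H v y Bool.≟ true)

removeVertex : Fin (suc m) → Graph (suc m) → Graph m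
removeVertex v H = record
  { adj    = λ i j → adj H (punchIn v i) (punchIn v j)
  ; sym    = λ i j → adj-sym H (punchIn v i) (punchIn v j)
  ; irrefl = λ i → irrefl H (punchIn v i)
  }

removeVertexᶜ : (v : Fin (suc m)) {H : Graph (suc m)} →
                EdgeColouring H → EdgeColouring (removeVertex v H)
removeVertexᶜ v c = record
  { colour     = λ i j → colour c (punchIn v i) (punchIn v j)
  ; colour-sym = λ i j → colour-sym c (punchIn v i) (punchIn v j)
  }

punchIn-≢ : (v : Fin (suc m)) {i j : Fin m} → i ≢ j → punchIn v i ≢ punchIn v j
punchIn-≢ v i≢j = i≢j ∘ punchIn-injective v _ _

removeVertex-B₃-free : (v : Fin (suc m)) {G : Graph (suc m)} →
                       B₃-free G → B₃-free (removeVertex v G)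
removeVertex-B₃-free v free
  (x , y , a , b , c , x≢y , x≢a , x≢b , x≢c , y≢a , y≢b , y≢c , a≢b , a≢c , b≢c , edges) =
  free (punchIn v x , punchIn v y , punchIn v a , punchIn v b , punchIn v c ,
        ↑ x≢y , ↑ x≢a , ↑ x≢b , ↑ x≢c , ↑ y≢a , ↑ y≢b , ↑ y≢c , ↑ a≢b , ↑ a≢c , ↑ b≢c , edges)
  where ↑ = punchIn-≢ v

data PunchInView (v : Fin (suc m)) : Fin (suc m) → Set where
  at       : PunchInView v v
  punched  : (j : Fin m) → PunchInView v (punchIn v j)

punchInView : (v x : Fin (suc m)) → PunchInView v x
punchInView v x with v ≟ x
... | yes refl = at
... | no v≢x   = subst (PunchInView v) (punchIn-punchOut v≢x) (punched (punchOut v≢x))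

MaxDegree≤2 : Graph m → Set
MaxDegree≤2 H = ∀ x a b c → a ≢ b → a ≢ c → b ≢ c →
                Edge H x a → Edge H x b → Edge H x c → ⊥

Degree≤1 : Graph m → Fin m → Set
Degree≤1 H w = ∀ a b → a ≢ b → Edge H w a → Edge H w b → ⊥

AvoidsEdgeColours : (H : Graph m) → EdgeColouring H → (Fin m → Bool) → Set
AvoidsEdgeColours H c f =
  ∀ x y → Edge H x y → f x ≡ colour c x y → f y ≡ colour c x y → ⊥

removeVertex-maxDegree≤2 : (v : Fin (suc m)) {H : Graph (suc m)} →
                           MaxDegree≤2 H → MaxDegree≤2 (removeVertex v H)
removeVertex-maxDegree≤2 v Δ x a b c a≢b a≢c b≢c =
  Δ (punchIn v x) _ _ _ (punchIn-≢ v a≢b) (punchIn-≢ v a≢c) (punchIn-≢ v b≢c)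

removeVertex-degree≤1 : {H : Graph (suc m)} {v y : Fin (suc m)} →
                        MaxDegree≤2 H → Edge H v y → (v≢y : v ≢ y) →
                        Degree≤1 (removeVertex v H) (punchOut v≢y)
removeVertex-degree≤1 {H = H} {v} Δ vy v≢y a b a≢b ya yb =
  Δ _ (punchIn v a) (punchIn v b) v (punchIn-≢ v a≢b) (punchInᵢ≢i v a) (punchInᵢ≢i v b)
    (subst (λ y → Edge H y (punchIn v a)) (punchIn-punchOut v≢y) ya)
    (subst (λ y → Edge H y (punchIn v b)) (punchIn-punchOut v≢y) yb)
    (edge-sym H vy)

module _ {H : Graph (suc m)} {c : EdgeColouring H} {v : Fin (suc m)} where

  insertAt-avoids : {f : Fin m → Bool} {val : Bool} →
                    AvoidsEdgeColours (removeVertex v H) (removeVertexᶜ v c) f →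
                    (∀ j → Edge H v (punchIn v j) →
                       val ≡ colour c v (punchIn v j) → f j ≡ colour c v (punchIn v j) → ⊥) →
                    AvoidsEdgeColours H c (insertAt f v val)
  insertAt-avoids {f} {val} avoids at-v x y xy fx fy
    with punchInView v x | punchInView v y
  ... | at        | at        = edge⇒≢ H xy refl
  ... | at        | punched j =
    at-v j xy (trans (sym (insertAt-lookup f v val)) fx)
              (trans (sym (insertAt-punchIn f v val j)) fy)
  ... | punched i | at        =
    at-v i (edge-sym H xy) (trans (sym (insertAt-lookup f v val)) (trans fy (colour-sym c _ v)))
                           (trans (sym (insertAt-punchIn f v val i)) (trans fx (colour-sym c _ v)))
  ... | punched i | punched j =
    avoids i j xy (trans (sym (insertAt-punchIn f v val i)) fx)
                  (trans (sym (insertAt-punchIn f v val j)) fy)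

  insertAt-avoids-isolated : {f : Fin m → Bool} (val : Bool) → ¬ (∃[ y ] Edge H v y) →
                             AvoidsEdgeColours (removeVertex v H) (removeVertexᶜ v c) f →
                             AvoidsEdgeColours H c (insertAt f v val)
  insertAt-avoids-isolated val isolated avoids =
    insertAt-avoids avoids (λ j vj _ _ → isolated (punchIn v j , vj))

  insertAt-avoids-along : {y : Fin (suc m)} {f : Fin m → Bool} {val : Bool} (v≢y : v ≢ y) →
                          f (punchOut v≢y) ≡ not (colour c v y) →
                          (∀ x → Edge H v x → x ≢ y → val ≢ colour c v x) →
                          AvoidsEdgeColours (removeVertex v H) (removeVertexᶜ v c) f →
                          AvoidsEdgeColours H c (insertAt f v val)
  insertAt-avoids-along {y} {f} {val} v≢y fy≡¬c avoidsOthers avoids =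
    insertAt-avoids avoids at-v
    where
    at-v : ∀ j → Edge H v (punchIn v j) →
           val ≡ colour c v (punchIn v j) → f j ≡ colour c v (punchIn v j) → ⊥
    at-v j vj val≡c fj≡c with punchIn v j ≟ y
    ... | no  j≢y = avoidsOthers (punchIn v j) vj j≢y val≡c
    ... | yes vj≡y = Bool.not-¬ (trans (cong f (sym j≡y)) (trans fj≡c cvj≡cvy)) fy≡¬c
      where
      j≡y = punchIn-injective v _ _ (trans vj≡y (sym (punchIn-punchOut v≢y)))
      cvj≡cvy = cong (colour c v) vj≡y

avoidingValue : {H : Graph m} (c : EdgeColouring H) {v y : Fin m} →
                MaxDegree≤2 H → Edge H v y →
                ∃[ val ] (∀ x → Edge H v x → x ≢ y → val ≢ colour c v x)
avoidingValue {H = H} c {v} {y} Δ vy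
  with any? (λ z → ¬? (z ≟ y) ×-dec (adj H v z Bool.≟ true))
... | no noOther = false , λ x vx x≢y _ → noOther (x , x≢y , vx)
... | yes (z , z≢y , vz) = not (colour c v z) , avoids
  where
  avoids : ∀ x → Edge H v x → x ≢ y → not (colour c v z) ≢ colour c v x
  avoids x vx x≢y ¬cz≡cx with x ≟ z
  ... | yes refl = Bool.not-¬ refl (sym ¬cz≡cx)
  ... | no  x≢z  = Δ v y z x (z≢y ∘ sym) (x≢y ∘ sym) (x≢z ∘ sym) vy vz vx

PinnedColouring : (H : Graph m) → EdgeColouring H → Fin m → Bool → Set
PinnedColouring H c v val = ∃[ f ] (AvoidsEdgeColours H c f × f v ≡ val)

mutual

  avoidingColouring : {H : Graph m} → MaxDegree≤2 H → (c : EdgeColouring H) →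
                      ∃[ f ] AvoidsEdgeColours H c f
  avoidingColouring {m = zero} _ _ = (λ ()) , λ ()
  avoidingColouring {m = suc m} {H = H} Δ c with neighbour? H zero
  ... | no isolated =
    let f , avoids , _ = colourIsolated Δ c false isolated in f , avoids
  ... | yes (y , vy) =
    let val , avoidsOthers = avoidingValue c Δ vy
        f , avoids , _ = colourAlong Δ c vy avoidsOthers
    in f , avoids

  pinnedColouring : {H : Graph m} → MaxDegree≤2 H → (c : EdgeColouring H) →
                    (w : Fin m) → Degree≤1 H w → (κ : Bool) → PinnedColouring H c w κ
  pinnedColouring {m = suc m} {H = H} Δ c w deg κ with neighbour? H w
  ... | no isolated  = colourIsolated Δ c κ isolated
  ... | yes (y , wy) = colourAlong Δ c wy (λ x wx x≢y _ → deg x y x≢y wx wy)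

  colourIsolated : {H : Graph (suc m)} {v : Fin (suc m)} → MaxDegree≤2 H →
                   (c : EdgeColouring H) (val : Bool) → ¬ (∃[ y ] Edge H v y) →
                   PinnedColouring H c v val
  colourIsolated {H = H} {v} Δ c val isolated =
    let f , avoids = avoidingColouring (removeVertex-maxDegree≤2 v {H} Δ) (removeVertexᶜ v c)
    in insertAt f v val ,
       insertAt-avoids-isolated {c = c} val isolated avoids ,
       insertAt-lookup f v val

  colourAlong : {H : Graph (suc m)} {v y : Fin (suc m)} → MaxDegree≤2 H →
                (c : EdgeColouring H) → Edge H v y → {val : Bool} →
                (∀ x → Edge H v x → x ≢ y → val ≢ colour c v x) →
                PinnedColouring H c v val
  colourAlong {H = H} {v} {y} Δ c vy {val} avoidsOthers =
    let v≢y = edge⇒≢ H vy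
        f , avoids , fy≡¬c =
          pinnedColouring (removeVertex-maxDegree≤2 v {H} Δ) (removeVertexᶜ v c)
                          (punchOut v≢y) (removeVertex-degree≤1 {H = H} Δ vy v≢y)
                          (not (colour c v y))
    in insertAt f v val ,
       insertAt-avoids-along {c = c} v≢y fy≡¬c avoidsOthers avoids ,
       insertAt-lookup f v val

-- The link of vertex 0, on all of G − 0: non-neighbours of 0 are isolated.
link : Graph (suc m) → Graph m
link G = record
  { adj    = λ i j → (adj G zero (suc i) ∧ adj G zero (suc j)) ∧ adj G (suc i) (suc j)
  ; sym    = λ i j → cong₂ _∧_ (Bool.∧-comm (adj G zero (suc i)) (adj G zero (suc j)))
                                 (adj-sym G (suc i) (suc j))
  ; irrefl = λ i → let 0i = adj G zero (suc i) in
                   trans (cong ((0i ∧ 0i) ∧_) (irrefl G (suc i))) (Bool.∧-zeroʳ (0i ∧ 0i))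
  }

module _ {G : Graph (suc m)} where

  linkᶜ : EdgeColouring (removeVertex zero G) → EdgeColouring (link G)
  linkᶜ c = record { colour = colour c ; colour-sym = colour-sym c }

  link-edge : {i j : Fin m} → Edge G zero (suc i) → Edge G zero (suc j) →
              Edge G (suc i) (suc j) → Edge (link G) i j
  link-edge 0i 0j ij rewrite 0i | 0j | ij = refl

  link-edge⁻¹ : {i j : Fin m} → Edge (link G) i j →
                Edge G zero (suc i) × Edge G zero (suc j) × Edge G (suc i) (suc j)
  link-edge⁻¹ {i} {j} e with adj G zero (suc i) | adj G zero (suc j) | adj G (suc i) (suc j)
  ... | true | true | true = refl , refl , refl

  link-maxDegree≤2 : B₃-free G → MaxDegree≤2 (link G)
  link-maxDegree≤2 free x a b c a≢b a≢c b≢c xa xb xc =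
    let 0x , 0a , x-a = link-edge⁻¹ xa
        _  , 0b , x-b = link-edge⁻¹ xb
        _  , 0c , x-c = link-edge⁻¹ xc
    in free (zero , suc x , suc a , suc b , suc c ,
             (λ ()) , (λ ()) , (λ ()) , (λ ()) ,
             edge⇒≢ G x-a , edge⇒≢ G x-b , edge⇒≢ G x-c ,
             a≢b ∘ suc-injective , a≢c ∘ suc-injective , b≢c ∘ suc-injective ,
             0x , 0a , x-a , 0b , x-b , 0c , x-c)

  cone : EdgeColouring (removeVertex zero G) → (Fin m → Bool) → EdgeColouring G
  cone c f = record { colour = colour′ ; colour-sym = colour′-sym }
    where
    colour′ : Fin (suc m) → Fin (suc m) → Bool
    colour′ zero    zero    = false
    colour′ zero    (suc j) = f j
    colour′ (suc i) zero    = f i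
    colour′ (suc i) (suc j) = colour c i j

    colour′-sym : ∀ x y → colour′ x y ≡ colour′ y x
    colour′-sym zero    zero    = refl
    colour′-sym zero    (suc j) = refl
    colour′-sym (suc i) zero    = refl
    colour′-sym (suc i) (suc j) = colour-sym c i j

  cone-noMono : {c : EdgeColouring (removeVertex zero G)} {f : Fin m → Bool} →
                ¬ MonoTriangle (removeVertex zero G) c →
                AvoidsEdgeColours (link G) (linkᶜ c) f →
                ¬ MonoTriangle G (cone c f)
  cone-noMono noMono avoids (zero , zero , _ , x≢y , _) = x≢y refl
  cone-noMono noMono avoids (_ , zero , zero , _ , _ , y≢z , _) = y≢z refl
  cone-noMono noMono avoids (zero , suc y , zero , _ , x≢z , _) = x≢z refl
  cone-noMono noMono avoids (zero , suc y , suc z , _ , _ , _ , 0y , 0z , yz , fy≡fz , fy≡c) =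
    avoids y z (link-edge 0y 0z yz) fy≡c (trans (sym fy≡fz) fy≡c)
  cone-noMono noMono avoids (suc x , zero , suc z , _ , _ , _ , x0 , xz , 0z , fx≡c , fx≡fz) =
    avoids x z (link-edge (edge-sym G x0) 0z xz) fx≡c (trans (sym fx≡fz) fx≡c)
  cone-noMono noMono avoids (suc x , suc y , zero , _ , _ , _ , xy , x0 , y0 , c≡fx , c≡fy) =
    avoids x y (link-edge (edge-sym G x0) (edge-sym G y0) xy) (sym c≡fx) (sym c≡fy)
  cone-noMono noMono avoids
    (suc x , suc y , suc z , x≢y , x≢z , y≢z , xy , xz , yz , cxy≡cxz , cxy≡cyz) =
    noMono (x , y , z , x≢y ∘ cong suc , x≢z ∘ cong suc , y≢z ∘ cong suc ,
            xy , xz , yz , cxy≡cxz , cxy≡cyz)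

theorem6 : (n : ℕ) (G : Graph n) → B₃-free G →
           ∃[ c ] ¬ MonoTriangle G c
theorem6 zero    G free = record { colour = λ () ; colour-sym = λ () } , λ { (() , _) }
theorem6 (suc n) G free =
  let c , noMono = theorem6 n (removeVertex zero G) (removeVertex-B₃-free zero {G} free)
      f , avoids = avoidingColouring (link-maxDegree≤2 {G = G} free) (linkᶜ {G = G} c)
  in cone c f , cone-noMono {c = c} noMono avoids
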